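{- Let $P$ be a finite poset, let $\varepsilon'>0$ and let $j\in\{1,2\}$. Then there exist positive integers $N,K$ and maps $f_1,\dots,f_K:P\to B_N$ such that: (i) for every $i\in[1,K]$, $f_i$ is an embedding if $j=1$ and an induced embedding if $j=2$; (ii) $K\ge \dfrac{2^N(1-\varepsilon')}{t_j(P)}$; (iii) whenever $i_1<i_2$, $a\in\mathrm{Im}(f_{i_1})$ and $b\in\mathrm{Im}(f_{i_2})$, we have $b\not\subseteq a$.
   Context: $B_N$ denotes the poset of all subsets of $[N]$ ordered by inclusion. For a finite poset $(P,<_p)$, an embedding $f:P\to B_N$ is an injective map with $f(a)\subset f(b)$ whenever $a<_p b$; an induced embedding is an injective map with $f(a)\subset f(b)$ if and only if $a<_p b$. For $F\subseteq B_n$, $\mathrm{conv}(F)=\{b\in B_n:\exists a,c\in F,\ a\subseteq b\subseteq c\}$. $t_1(P)$ (resp. $t_2(P)$) is the minimum of $|\mathrm{conv}(\mathrm{Im}(f))|$ over all $n$ and all embeddings (resp. induced embeddings) $f:P\to B_n$.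
   Formalization: The parameter $\varepsilon'$ ranges over the positive rationals. -}

module Defs where

open import Level using (Level)
open import Data.Nat using (ℕ; zero; suc)
open import Data.Fin using (Fin)
open import Data.Fin.Subset using (Subset; _⊆_; _⊂_; inside; outside)
open import Data.Fin.Subset.Properties using (_⊆?_)
open import Data.Fin.Properties using (any?)
open import Data.List using (List; []; _∷_; _++_; map; filter; length)
open import Data.Vec using (_∷_; [])
open import Data.Product using (Σ; ∃; _×_; _,_)
open import Relation.Nullary using (Dec; ¬_)
open import Relation.Nullary.Decidable using (_×-dec_)
open import Relation.Binary using (Rel)
open import Function.Definitions using (Injective)
open import Relation.Binary.PropositionalEquality using (_≡_)

allSubsets : (n : ℕ) → List (Subset n)
allSubsets zero = [] ∷ []
allSubsets (suc n) = map (inside ∷_) (allSubsets n) ++ map (outside ∷_) (allSubsets n)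

InConv : {m n : ℕ} → (Fin m → Subset n) → Subset n → Set
InConv {m} f b = ∃ λ (x : Fin m) → ∃ λ (y : Fin m) → (f x ⊆ b) × (b ⊆ f y)

inConv? : {m n : ℕ} (f : Fin m → Subset n) (b : Subset n) → Dec (InConv f b)
inConv? f b = any? λ x → any? λ y → (f x ⊆? b) ×-dec (b ⊆? f y)

convSize : {m n : ℕ} → (Fin m → Subset n) → ℕ
convSize {n = n} f = length (filter (inConv? f) (allSubsets n))

IsEmbedding : {ℓ : Level} {m n : ℕ} → Rel (Fin m) ℓ → (Fin m → Subset n) → Set ℓ
IsEmbedding _<ₚ_ f = Injective _≡_ _≡_ f × (∀ a b → a <ₚ b → f a ⊂ f b)

IsInducedEmbedding : {ℓ : Level} {m n : ℕ} → Rel (Fin m) ℓ → (Fin m → Subset n) → Set ℓ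
IsInducedEmbedding _<ₚ_ f =
  Injective _≡_ _≡_ f × (∀ a b → (f a ⊂ f b → a <ₚ b) × (a <ₚ b → f a ⊂ f b))

data J : Set where
  j₁ j₂ : J

IsEmb : {ℓ : Level} {m n : ℕ} → J → Rel (Fin m) ℓ → (Fin m → Subset n) → Set ℓ
IsEmb j₁ _<ₚ_ f = IsEmbedding _<ₚ_ f
IsEmb j₂ _<ₚ_ f = IsInducedEmbedding _<ₚ_ f

-- t is t_j(P): attained by some (induced) embedding, and a lower bound for all
IsT : {ℓ : Level} {m : ℕ} → J → Rel (Fin m) ℓ → ℕ → Set ℓ
IsT {m = m} j _<ₚ_ t =
  (Σ ℕ λ n → Σ (Fin m → Subset n) λ f → IsEmb j _<ₚ_ f × convSize f ≡ t)
  × (∀ (n : ℕ) (f : Fin m → Subset n) → IsEmb j _<ₚ_ f → Data.Nat._≤_ t (convSize f))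

-- Fix an embedding f : P → B_n whose convex hull has t elements, and split B_n into that hull,
-- the region L of sets containing no f x, and the region H of sets above some f x but below none.
-- No set of a later region among L, hull, H lies inside a set of an earlier one. Hence, from a
-- family of embeddings into B_N in which no image of a later member lies inside an image of an
-- earlier one, we get such a family into B_(n+N): first z ++ g for z ∈ L and g in the family,
-- then f ++ y for every y ∈ B_N, then z ++ g for z ∈ H. Starting from the empty family, after M
-- rounds its size K satisfies K t + (2^n − t)^M = 2^(nM), and (2^n − t)^M is a vanishing
-- fraction of 2^(nM) as M grows.

module Submission where

open import Defs
open import Level using (Level; 0ℓ)
open import Data.Nat using (ℕ; zero; suc; _+_; _*_; _∸_; _^_; _≤_; _<_; z≤n; s≤s)
open import Data.Nat.Properties
open import Data.Fin using (Fin) renaming (zero to fzero; suc to fsuc)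
open import Data.Fin.Properties using (all?; any?)
open import Data.Fin.Subset using (Subset; _⊆_; _⊈_; _⊉_; _⊂_; inside; outside)
open import Data.Fin.Subset.Properties
  using ( _⊆?_; ⊆-refl; ⊆-trans; ⊆-antisym; ⊂-irref; drop-∷-⊆; drop-∷-⊂
        ; out⊆; in⊆in; out⊂; in⊂in; out⊂in; s⊂s )
open import Data.List using (List; []; _∷_; _++_; map; filter; length; lookup; cartesianProductWith)
open import Data.List.Properties using (length-++; length-map; filter-accept; filter-reject; filter-some)
open import Data.List.Membership.Propositional using (_∈_; lose)
open import Data.List.Membership.Propositional.Properties using (∈-map⁺; ∈-++⁺ˡ; ∈-++⁺ʳ; ∈-lookup)
open import Data.List.Relation.Unary.Any using (here)
open import Data.List.Relation.Unary.All as All using (All; universal-U)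
import Data.List.Relation.Unary.All.Properties as All
open import Data.List.Relation.Unary.AllPairs as AllPairs using (AllPairs; _∷_)
import Data.List.Relation.Unary.AllPairs.Properties as AllPairs
open import Data.List.Relation.Binary.Permutation.Propositional using (_↭_; ↭-refl; ↭-trans)
import Data.List.Relation.Binary.Permutation.Propositional.Properties as ↭
open import Data.Vec using ([]; _∷_) renaming (_++_ to _++ᵥ_)
open import Data.Vec.Base using (here)
open import Data.Vec.Properties using (++-injectiveˡ; ++-injectiveʳ)
open import Data.Product using (Σ; ∃; _×_; _,_; proj₁; proj₂)
open import Data.Sum using (inj₁; inj₂)
open import Function using (_∘_; const)
open import Function.Definitions using (Injective)
open import Relation.Nullary using (¬_; ¬?; yes; no; contradiction)
open import Relation.Nullary.Decidable using (_×-dec_)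
open import Relation.Unary using (Pred; Decidable; Universal; _∪_; _⊥_)
open import Relation.Binary using (Rel; IsStrictPartialOrder)
open import Relation.Binary.Morphism.Structures using (IsOrderMonomorphism)
open import Relation.Binary.PropositionalEquality
  using (_≡_; refl; cong; cong₂; sym; trans; subst; module ≡-Reasoning)

private
  variable
    ℓ ℓ₁ ℓ₂ ℓ₃ : Level
    A B C : Set
    k m n N : ℕ

⊆-∷-tails : ∀ {s t} {p q : Subset k} {p′ q′ : Subset N} →
  s ∷ p ⊆ t ∷ q → p′ ⊆ q′ → s ∷ p′ ⊆ t ∷ q′
⊆-∷-tails {s = outside} _ p′⊆q′ = out⊆ p′⊆q′
⊆-∷-tails {s = inside} {inside} _ p′⊆q′ = in⊆in p′⊆q′
⊆-∷-tails {s = inside} {outside} sp⊆tq _ = contradiction (sp⊆tq here) λ ()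

++-⊆⁺ : ∀ (p q : Subset k) {u v : Subset N} → p ⊆ q → u ⊆ v → p ++ᵥ u ⊆ q ++ᵥ v
++-⊆⁺ [] [] _ u⊆v = u⊆v
++-⊆⁺ (_ ∷ p) (_ ∷ q) sp⊆tq u⊆v = ⊆-∷-tails sp⊆tq (++-⊆⁺ p q (drop-∷-⊆ sp⊆tq) u⊆v)

++-⊆⁻ˡ : ∀ (p q : Subset k) {u v : Subset N} → p ++ᵥ u ⊆ q ++ᵥ v → p ⊆ q
++-⊆⁻ˡ [] [] _ {()}
++-⊆⁻ˡ (_ ∷ p) (_ ∷ q) h = ⊆-∷-tails h (++-⊆⁻ˡ p q (drop-∷-⊆ h))

++-⊆⁻ʳ : ∀ (p q : Subset k) {u v : Subset N} → p ++ᵥ u ⊆ q ++ᵥ v → u ⊆ v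
++-⊆⁻ʳ [] [] h = h
++-⊆⁻ʳ (_ ∷ p) (_ ∷ q) h = ++-⊆⁻ʳ p q (drop-∷-⊆ h)

prepend-⊂⁺ : ∀ (z : Subset k) {u v : Subset N} → u ⊂ v → z ++ᵥ u ⊂ z ++ᵥ v
prepend-⊂⁺ [] u⊂v = u⊂v
prepend-⊂⁺ (_ ∷ z) u⊂v = s⊂s (prepend-⊂⁺ z u⊂v)

prepend-⊂⁻ : ∀ (z : Subset k) {u v : Subset N} → z ++ᵥ u ⊂ z ++ᵥ v → u ⊂ v
prepend-⊂⁻ [] h = h
prepend-⊂⁻ (_ ∷ z) h = prepend-⊂⁻ z (drop-∷-⊂ h)

append-⊂⁺ : ∀ (p q : Subset k) {y : Subset N} → p ⊂ q → p ++ᵥ y ⊂ q ++ᵥ y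
append-⊂⁺ [] [] (_ , () , _)
append-⊂⁺ (outside ∷ p) (outside ∷ q) h = out⊂ (append-⊂⁺ p q (drop-∷-⊂ h))
append-⊂⁺ (inside ∷ p) (inside ∷ q) h = in⊂in (append-⊂⁺ p q (drop-∷-⊂ h))
append-⊂⁺ (outside ∷ p) (inside ∷ q) (sp⊆tq , _) =
  out⊂in (++-⊆⁺ p q (drop-∷-⊆ sp⊆tq) ⊆-refl)
append-⊂⁺ (inside ∷ p) (outside ∷ q) (sp⊆tq , _) = contradiction (sp⊆tq here) λ ()

append-⊂⁻ : ∀ (p q : Subset k) {y : Subset N} → p ++ᵥ y ⊂ q ++ᵥ y → p ⊂ q
append-⊂⁻ [] [] (_ , x , x∈y , x∉y) = contradiction x∈y x∉y
append-⊂⁻ (outside ∷ p) (outside ∷ q) h = out⊂ (append-⊂⁻ p q (drop-∷-⊂ h))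
append-⊂⁻ (inside ∷ p) (inside ∷ q) h = in⊂in (append-⊂⁻ p q (drop-∷-⊂ h))
append-⊂⁻ (outside ∷ p) (inside ∷ q) (sp⊆tq , _) = out⊂in (++-⊆⁻ˡ p q (drop-∷-⊆ sp⊆tq))
append-⊂⁻ (inside ∷ p) (outside ∷ q) (sp⊆tq , _) = contradiction (sp⊆tq here) λ ()

prepend-isOrderMonomorphism : (z : Subset k) →
  IsOrderMonomorphism {A = Subset N} _≡_ _≡_ _⊂_ _⊂_ (z ++ᵥ_)
prepend-isOrderMonomorphism z = record
  { isOrderHomomorphism = record { cong = cong (z ++ᵥ_) ; mono = prepend-⊂⁺ z }
  ; injective = ++-injectiveʳ z z
  ; cancel = prepend-⊂⁻ z
  }

append-isOrderMonomorphism : (y : Subset N) →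
  IsOrderMonomorphism {A = Subset k} _≡_ _≡_ _⊂_ _⊂_ (_++ᵥ y)
append-isOrderMonomorphism y = record
  { isOrderHomomorphism = record { cong = cong (_++ᵥ y) ; mono = append-⊂⁺ _ _ }
  ; injective = ++-injectiveˡ _ _
  ; cancel = append-⊂⁻ _ _
  }

IsEmb-injective : ∀ {R : Rel (Fin m) ℓ} {g : Fin m → Subset n} j → IsEmb j R g → Injective _≡_ _≡_ g
IsEmb-injective j₁ = proj₁
IsEmb-injective j₂ = proj₁

IsEmb-∘ : ∀ {R : Rel (Fin m) ℓ} {φ : Subset k → Subset N} j {g : Fin m → Subset k} →
  IsOrderMonomorphism _≡_ _≡_ _⊂_ _⊂_ φ → IsEmb j R g → IsEmb j R (φ ∘ g)
IsEmb-∘ j₁ φ-mono (g-inj , g-mono) = g-inj ∘ injective , λ a b → mono ∘ g-mono a b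
  where open IsOrderMonomorphism φ-mono
IsEmb-∘ j₂ φ-mono (g-inj , g-iff) =
  g-inj ∘ injective , λ a b → proj₁ (g-iff a b) ∘ cancel , mono ∘ proj₂ (g-iff a b)
  where open IsOrderMonomorphism φ-mono

Fin1-≡ : (x y : Fin 1) → x ≡ y
Fin1-≡ fzero fzero = refl

onePoint-isEmb : ∀ {R : Rel (Fin 1) ℓ} → IsStrictPartialOrder _≡_ R →
  ∀ j (c : Subset n) → IsEmb j R (const c)
onePoint-isEmb spo j₁ c = (λ _ → Fin1-≡ _ _) , λ a b aRb → contradiction aRb (irrefl (Fin1-≡ a b))
  where open IsStrictPartialOrder spo
onePoint-isEmb spo j₂ c =
  (λ _ → Fin1-≡ _ _) ,
  λ a b → (λ c⊂c → contradiction c⊂c (⊂-irref refl)) , λ aRb → contradiction aRb (irrefl (Fin1-≡ a b))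
  where open IsStrictPartialOrder spo

-- allSubsets with the opposite order on first coordinates, so that no set contains a later one
subsets : (k : ℕ) → List (Subset k)
subsets zero = [] ∷ []
subsets (suc k) = map (outside ∷_) (subsets k) ++ map (inside ∷_) (subsets k)

length-subsets : ∀ k → length (subsets k) ≡ 2 ^ k
length-subsets zero = refl
length-subsets (suc k) = begin
  length (map (outside ∷_) (subsets k) ++ map (inside ∷_) (subsets k))
    ≡⟨ length-++ (map (outside ∷_) (subsets k)) ⟩
  length (map (outside ∷_) (subsets k)) + length (map (inside ∷_) (subsets k))
    ≡⟨ cong₂ _+_ (length-map _ (subsets k)) (length-map _ (subsets k)) ⟩
  length (subsets k) + length (subsets k)
    ≡⟨ cong₂ _+_ (length-subsets k) (trans (length-subsets k) (sym (+-identityʳ (2 ^ k)))) ⟩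
  2 ^ k + (2 ^ k + 0) ∎
  where open ≡-Reasoning

∈-subsets : (z : Subset k) → z ∈ subsets k
∈-subsets [] = here refl
∈-subsets (outside ∷ z) = ∈-++⁺ˡ (∈-map⁺ (outside ∷_) (∈-subsets z))
∈-subsets (inside ∷ z) = ∈-++⁺ʳ _ (∈-map⁺ (inside ∷_) (∈-subsets z))

∷-⊉ : ∀ {s t} {p q : Subset k} → p ⊉ q → (s ∷ p) ⊉ (t ∷ q)
∷-⊉ p⊉q tq⊆sp = p⊉q (drop-∷-⊆ tq⊆sp)

subsets-⊉ : ∀ k → AllPairs _⊉_ (subsets k)
subsets-⊉ zero = All.[] ∷ AllPairs.[]
subsets-⊉ (suc k) = AllPairs.++⁺ (tails-⊉ outside) (tails-⊉ inside)
  (All.map⁺ (All.universal (λ _ → All.map⁺ (All.universal (λ _ → out⊉in) (subsets k))) (subsets k)))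
  where
  tails-⊉ : ∀ s → AllPairs _⊉_ (map (s ∷_) (subsets k))
  tails-⊉ s = AllPairs.map⁺ (AllPairs.map ∷-⊉ (subsets-⊉ k))
  out⊉in : ∀ {p q : Subset k} → (outside ∷ p) ⊉ (inside ∷ q)
  out⊉in iq⊆op = contradiction (iq⊆op here) λ ()

subsets↭allSubsets : ∀ k → subsets k ↭ allSubsets k
subsets↭allSubsets zero = ↭-refl
subsets↭allSubsets (suc k) = ↭-trans (↭.++-comm (map (outside ∷_) (subsets k)) _)
  (↭.++⁺ (↭.map⁺ (inside ∷_) (subsets↭allSubsets k))
         (↭.map⁺ (outside ∷_) (subsets↭allSubsets k)))

convSize-subsets : (g : Fin m → Subset n) → convSize g ≡ length (filter (inConv? g) (subsets n))
convSize-subsets {n = n} g = sym (↭.↭-length (↭.filter-↭ (inConv? g) (subsets↭allSubsets n)))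

length-cartesianProductWith : ∀ (f : A → B → C) xs ys →
  length (cartesianProductWith f xs ys) ≡ length xs * length ys
length-cartesianProductWith f [] ys = refl
length-cartesianProductWith f (x ∷ xs) ys = trans (length-++ (map (f x) ys))
  (cong₂ _+_ (length-map (f x) ys) (length-cartesianProductWith f xs ys))

module _ {f : A → B → C} {P : Pred A ℓ₁} {Q : Pred B ℓ₂} {R : Pred C ℓ₃} where

  cartesianProductWith⁺ : (∀ {x y} → P x → Q y → R (f x y)) →
    ∀ {xs ys} → All P xs → All Q ys → All R (cartesianProductWith f xs ys)
  cartesianProductWith⁺ pres All.[] _ = All.[]
  cartesianProductWith⁺ pres (px All.∷ pxs) qys =
    All.++⁺ (All.map⁺ (All.map (pres px) qys)) (cartesianProductWith⁺ pres pxs qys)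

module _ {f : A → B → C} {R : Rel A ℓ₁} {T : Rel B ℓ₂} {S : Rel C ℓ₃} where

  AllPairs-cartesianProductWith⁺ : (∀ {x x′} → R x x′ → ∀ y y′ → S (f x y) (f x′ y′)) →
    (∀ x {y y′} → T y y′ → S (f x y) (f x y′)) →
    ∀ {xs ys} → AllPairs R xs → AllPairs T ys → AllPairs S (cartesianProductWith f xs ys)
  AllPairs-cartesianProductWith⁺ across within AllPairs.[] _ = AllPairs.[]
  AllPairs-cartesianProductWith⁺ across within {x ∷ xs} {ys} (Rx ∷ Rxs) Tys = AllPairs.++⁺
    (AllPairs.map⁺ (AllPairs.map (within x) Tys))
    (AllPairs-cartesianProductWith⁺ across within Rxs Tys)
    (All.map⁺ (All.universal
      (λ y → cartesianProductWith⁺ (λ r _ → across r y _) Rx (universal-U ys)) ys))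

length-filter-partition₃ : {P Q R : Pred A ℓ} (P? : Decidable P) (Q? : Decidable Q) (R? : Decidable R) →
  Universal (P ∪ Q ∪ R) → P ⊥ Q → P ⊥ R → Q ⊥ R →
  ∀ xs → length (filter P? xs) + length (filter Q? xs) + length (filter R? xs) ≡ length xs
length-filter-partition₃ P? Q? R? cover P⊥Q P⊥R Q⊥R [] = refl
length-filter-partition₃ P? Q? R? cover P⊥Q P⊥R Q⊥R (x ∷ xs)
  with ih ← length-filter-partition₃ P? Q? R? cover P⊥Q P⊥R Q⊥R xs | cover x
... | inj₁ px
  rewrite filter-accept P? {xs = xs} px | filter-reject Q? {xs = xs} (λ qx → P⊥Q (px , qx))
        | filter-reject R? {xs = xs} (λ rx → P⊥R (px , rx))
  = cong suc ih
... | inj₂ (inj₁ qx)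
  rewrite filter-reject P? {xs = xs} (λ px → P⊥Q (px , qx)) | filter-accept Q? {xs = xs} qx
        | filter-reject R? {xs = xs} (λ rx → Q⊥R (qx , rx))
  = trans (cong (_+ length (filter R? xs)) (+-suc (length (filter P? xs)) _)) (cong suc ih)
... | inj₂ (inj₂ rx)
  rewrite filter-reject P? {xs = xs} (λ px → P⊥R (px , rx))
        | filter-reject Q? {xs = xs} (λ qx → Q⊥R (qx , rx)) | filter-accept R? {xs = xs} rx
  = trans (+-suc _ (length (filter R? xs))) (cong suc ih)

All-lookup : ∀ {P : Pred A ℓ} {xs} → All P xs → ∀ i → P (lookup xs i)
All-lookup pxs i = All.lookup pxs (∈-lookup i)

AllPairs-lookup : ∀ {R : Rel A ℓ} {xs} → AllPairs R xs →
  ∀ i j → i Data.Fin.< j → R (lookup xs i) (lookup xs j)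
AllPairs-lookup (Rx ∷ _) fzero (fsuc j) _ = All-lookup Rx j
AllPairs-lookup (_ ∷ Rxs) (fsuc i) (fsuc j) (s≤s i<j) = AllPairs-lookup Rxs i j i<j

m^n*[m+n]≤[1+m]^n*m : ∀ m n → m ^ n * (m + n) ≤ suc m ^ n * m
m^n*[m+n]≤[1+m]^n*m m zero = ≤-reflexive (cong (_+ 0) (+-identityʳ m))
m^n*[m+n]≤[1+m]^n*m m (suc n) = begin
  m * X * (m + suc n)
    ≡⟨ solve 3 (λ m X n → m :* X :* (m :+ (con 1 :+ n)) := m :* X :* (m :+ n) :+ X :* m) refl m X n ⟩
  m * X * (m + n) + X * m
    ≤⟨ +-monoʳ-≤ (m * X * (m + n)) (*-monoʳ-≤ X (m≤m+n m n)) ⟩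
  m * X * (m + n) + X * (m + n)
    ≡⟨ solve 3 (λ m X n → m :* X :* (m :+ n) :+ X :* (m :+ n) := (con 1 :+ m) :* (X :* (m :+ n))) refl m X n ⟩
  suc m * (X * (m + n))
    ≤⟨ *-monoʳ-≤ (suc m) (m^n*[m+n]≤[1+m]^n*m m n) ⟩
  suc m * (suc m ^ n * m)
    ≡⟨ *-assoc (suc m) (suc m ^ n) m ⟨
  suc m * suc m ^ n * m ∎
  where
  open ≤-Reasoning
  open import Data.Nat.Solver using (module +-*-Solver)
  open +-*-Solver
  X : ℕ
  X = m ^ n

m^[1+m*q]*q≤[1+m]^[1+m*q] : ∀ m q → m ^ suc (m * q) * q ≤ suc m ^ suc (m * q)
m^[1+m*q]*q≤[1+m]^[1+m*q] zero q = z≤n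
m^[1+m*q]*q≤[1+m]^[1+m*q] m@(suc _) q = *-cancelʳ-≤ (m ^ M * q) (suc m ^ M) m (begin
  m ^ M * q * m     ≡⟨ *-assoc (m ^ M) q m ⟩
  m ^ M * (q * m)   ≤⟨ *-monoʳ-≤ (m ^ M) q*m≤m+M ⟩
  m ^ M * (m + M)   ≤⟨ m^n*[m+n]≤[1+m]^n*m m M ⟩
  suc m ^ M * m     ∎)
  where
  open ≤-Reasoning
  M : ℕ
  M = suc (m * q)
  q*m≤m+M : q * m ≤ m + M
  q*m≤m+M = ≤-trans (≤-reflexive (*-comm q m)) (≤-trans (n≤1+n (m * q)) (m≤n+m M m))

*-∸-bound : ∀ {B K t S} p q → 0 < p → K * t + S ≡ B → S * q ≤ B → B * (q ∸ p) ≤ K * t * q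
*-∸-bound {B} {K} {t} {S} p q 0<p B≡Kt+S Sq≤B = begin
  B * (q ∸ p)      ≤⟨ *-monoʳ-≤ B (∸-monoʳ-≤ q 0<p) ⟩
  B * (q ∸ 1)      ≡⟨ *-distribˡ-∸ B q 1 ⟩
  B * q ∸ B * 1    ≡⟨ cong (B * q ∸_) (*-identityʳ B) ⟩
  B * q ∸ B        ≤⟨ ∸-monoʳ-≤ (B * q) Sq≤B ⟩
  B * q ∸ S * q    ≡⟨ *-distribʳ-∸ q B S ⟨
  (B ∸ S) * q      ≡⟨ cong (λ b → (b ∸ S) * q) B≡Kt+S ⟨
  (K * t + S ∸ S) * q ≡⟨ cong (_* q) (m+n∸n≡m (K * t) S) ⟩
  K * t * q        ∎
  where open ≤-Reasoning

_++ᶠ_ : (Fin m → Subset k) → (Fin m → Subset N) → Fin m → Subset (k + N)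
(p ++ᶠ u) x = p x ++ᵥ u x

_⊉ᶠ_ : (Fin m → Subset N) → (Fin m → Subset N) → Set
g ⊉ᶠ h = ∀ x y → g x ⊉ h y

++ᶠ-⊉ᶠˡ : {p q : Fin m → Subset k} {u v : Fin m → Subset N} →
  p ⊉ᶠ q → (p ++ᶠ u) ⊉ᶠ (q ++ᶠ v)
++ᶠ-⊉ᶠˡ {p = p} {q} p⊉q x y = p⊉q x y ∘ ++-⊆⁻ˡ (q y) (p x)

++ᶠ-⊉ᶠʳ : {p q : Fin m → Subset k} {u v : Fin m → Subset N} →
  u ⊉ᶠ v → (p ++ᶠ u) ⊉ᶠ (q ++ᶠ v)
++ᶠ-⊉ᶠʳ {p = p} {q} u⊉v x y = u⊉v x y ∘ ++-⊆⁻ʳ (q y) (p x)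

module Extension {m n : ℕ} (f : Fin m → Subset n) where

  Low High : Pred (Subset n) 0ℓ
  Low z = ∀ x → f x ⊈ z
  High z = (∃ λ x → f x ⊆ z) × (∀ y → z ⊈ f y)

  low? : Decidable Low
  low? z = all? λ x → ¬? (f x ⊆? z)

  high? : Decidable High
  high? z = any? (λ x → f x ⊆? z) ×-dec all? (λ y → ¬? (z ⊆? f y))

  regions-cover : Universal (Low ∪ InConv f ∪ High)
  regions-cover z with any? (λ x → f x ⊆? z) | any? (λ y → z ⊆? f y)
  ... | no ∄below | _ = inj₁ λ x fx⊆z → ∄below (x , fx⊆z)
  ... | yes (x , fx⊆z) | yes (y , z⊆fy) = inj₂ (inj₁ (x , y , fx⊆z , z⊆fy))
  ... | yes below | no ∄above = inj₂ (inj₂ (below , λ y z⊆fy → ∄above (y , z⊆fy)))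

  Low⊥InConv : Low ⊥ InConv f
  Low⊥InConv (low , x , _ , fx⊆z , _) = low x fx⊆z

  Low⊥High : Low ⊥ High
  Low⊥High (low , (x , fx⊆z) , _) = low x fx⊆z

  InConv⊥High : InConv f ⊥ High
  InConv⊥High ((_ , y , _ , z⊆fy) , _ , above) = above y z⊆fy

  low-⊉ᶠ-f : ∀ {z} → Low z → const z ⊉ᶠ f
  low-⊉ᶠ-f low _ y = low y

  f-⊉ᶠ-high : ∀ {z} → High z → f ⊉ᶠ const z
  f-⊉ᶠ-high (_ , above) x _ = above x

  low-⊉ᶠ-high : ∀ {z z′} → Low z → High z′ → const {B = Fin m} z ⊉ᶠ const z′
  low-⊉ᶠ-high low ((x , fx⊆z′) , _) _ _ z′⊆z = low x (⊆-trans fx⊆z′ z′⊆z)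

  lows highs : List (Subset n)
  lows = filter low? (subsets n)
  highs = filter high? (subsets n)

  t a b : ℕ
  t = length (filter (inConv? f) (subsets n))
  a = length lows
  b = length highs

  a+t+b≡2^n : a + t + b ≡ 2 ^ n
  a+t+b≡2^n = trans
    (length-filter-partition₃ low? (inConv? f) high?
      regions-cover Low⊥InConv Low⊥High InConv⊥High (subsets n))
    (length-subsets n)

  a+b<2^n : 0 < t → a + b < 2 ^ n
  a+b<2^n 0<t = begin-strict
    a + b      ≡⟨ cong (_+ b) (+-identityʳ a) ⟨
    a + 0 + b  <⟨ +-monoˡ-< b (+-monoʳ-< a 0<t) ⟩
    a + t + b  ≡⟨ a+t+b≡2^n ⟩
    2 ^ n      ∎
    where open ≤-Reasoning

  prefixed : List (Subset n) → List (Fin m → Subset N) → List (Fin m → Subset (n + N))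
  prefixed = cartesianProductWith (λ z g → const z ++ᶠ g)

  suffixed : (N : ℕ) → List (Fin m → Subset (n + N))
  suffixed N = map (λ y → f ++ᶠ const y) (subsets N)

  extend : List (Fin m → Subset N) → List (Fin m → Subset (n + N))
  extend {N} L = prefixed lows L ++ suffixed N ++ prefixed highs L

  length-extend : (L : List (Fin m → Subset N)) → length (extend L) ≡ a * length L + (2 ^ N + b * length L)
  length-extend {N} L = begin
    length (prefixed lows L ++ suffixed N ++ prefixed highs L)
      ≡⟨ length-++ (prefixed lows L) ⟩
    length (prefixed lows L) + length (suffixed N ++ prefixed highs L)
      ≡⟨ cong (length (prefixed lows L) +_) (length-++ (suffixed N)) ⟩
    length (prefixed lows L) + (length (suffixed N) + length (prefixed highs L))
      ≡⟨ cong₂ (λ u v → u + (v + length (prefixed highs L))) (length-cartesianProductWith _ lows L)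
               (trans (length-map _ (subsets N)) (length-subsets N)) ⟩
    a * length L + (2 ^ N + length (prefixed highs L))
      ≡⟨ cong (λ v → a * length L + (2 ^ N + v)) (length-cartesianProductWith _ highs L) ⟩
    a * length L + (2 ^ N + b * length L) ∎
    where open ≡-Reasoning

  0<length-extend : (L : List (Fin m → Subset N)) → 0 < length (extend L)
  0<length-extend {N} L = begin-strict
    0                                      <⟨ m^n>0 2 N ⟩
    2 ^ N                                  ≤⟨ m≤m+n (2 ^ N) (b * length L) ⟩
    2 ^ N + b * length L                   ≤⟨ m≤n+m _ (a * length L) ⟩
    a * length L + (2 ^ N + b * length L)  ≡⟨ length-extend L ⟨
    length (extend L)                      ∎
    where open ≤-Reasoning

  prefixed-⊉ᶠ : ∀ {zs} {L : List (Fin m → Subset N)} →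
    AllPairs _⊉_ zs → AllPairs _⊉ᶠ_ L → AllPairs _⊉ᶠ_ (prefixed zs L)
  prefixed-⊉ᶠ = AllPairs-cartesianProductWith⁺ (λ z⊉z′ _ _ → ++ᶠ-⊉ᶠˡ λ _ _ → z⊉z′) (λ _ → ++ᶠ-⊉ᶠʳ)

  extend-⊉ᶠ : {L : List (Fin m → Subset N)} → AllPairs _⊉ᶠ_ L → AllPairs _⊉ᶠ_ (extend L)
  extend-⊉ᶠ {N} {L} L-⊉ᶠ =
    AllPairs.++⁺ (prefixed-⊉ᶠ (AllPairs.filter⁺ low? (subsets-⊉ n)) L-⊉ᶠ)
      (AllPairs.++⁺ suffixed-⊉ᶠ (prefixed-⊉ᶠ (AllPairs.filter⁺ high? (subsets-⊉ n)) L-⊉ᶠ)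
        suffixed-⊉ᶠ-highs)
      lows-⊉ᶠ-rest
    where
    suffixed-⊉ᶠ : AllPairs _⊉ᶠ_ (suffixed N)
    suffixed-⊉ᶠ = AllPairs.map⁺ (AllPairs.map (λ y⊉y′ → ++ᶠ-⊉ᶠʳ λ _ _ → y⊉y′) (subsets-⊉ N))
    ⊉ᶠ-highs : ∀ {p} {u : Fin m → Subset N} →
      (∀ {z} → High z → p ⊉ᶠ const z) → All ((p ++ᶠ u) ⊉ᶠ_) (prefixed highs L)
    ⊉ᶠ-highs p⊉ = cartesianProductWith⁺ (λ high _ → ++ᶠ-⊉ᶠˡ (p⊉ high))
      (All.all-filter high? (subsets n)) (universal-U L)
    suffixed-⊉ᶠ-highs : All (λ g → All (g ⊉ᶠ_) (prefixed highs L)) (suffixed N)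
    suffixed-⊉ᶠ-highs = All.map⁺ (All.universal (λ _ → ⊉ᶠ-highs f-⊉ᶠ-high) (subsets N))
    lows-⊉ᶠ-rest : All (λ g → All (g ⊉ᶠ_) (suffixed N ++ prefixed highs L)) (prefixed lows L)
    lows-⊉ᶠ-rest = cartesianProductWith⁺
      (λ low _ → All.++⁺ (All.map⁺ (All.universal (λ _ → ++ᶠ-⊉ᶠˡ (low-⊉ᶠ-f low)) (subsets N)))
                         (⊉ᶠ-highs (low-⊉ᶠ-high low)))
      (All.all-filter low? (subsets n)) (universal-U L)

  module _ {ℓ} {R : Rel (Fin m) ℓ} (j : J) (f-emb : IsEmb j R f) where

    prefixed-isEmb : ∀ zs {L : List (Fin m → Subset N)} →
      All (IsEmb j R) L → All (IsEmb j R) (prefixed zs L)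
    prefixed-isEmb zs L-emb = cartesianProductWith⁺
      (λ {z} _ g-emb → IsEmb-∘ j (prepend-isOrderMonomorphism z) g-emb) (universal-U zs) L-emb

    extend-isEmb : {L : List (Fin m → Subset N)} → All (IsEmb j R) L → All (IsEmb j R) (extend L)
    extend-isEmb {N} L-emb = All.++⁺ (prefixed-isEmb lows L-emb) (All.++⁺
      (All.map⁺ (All.universal (λ y → IsEmb-∘ j (append-isOrderMonomorphism y) f-emb) (subsets N)))
      (prefixed-isEmb highs L-emb))

  family : (M : ℕ) → List (Fin m → Subset (M * n))
  family zero = []
  family (suc M) = extend (family M)

  family-⊉ᶠ : ∀ M → AllPairs _⊉ᶠ_ (family M)
  family-⊉ᶠ zero = AllPairs.[]
  family-⊉ᶠ (suc M) = extend-⊉ᶠ (family-⊉ᶠ M)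

  family-isEmb : ∀ {ℓ} {R : Rel (Fin m) ℓ} j → IsEmb j R f → ∀ M → All (IsEmb j R) (family M)
  family-isEmb j f-emb zero = All.[]
  family-isEmb j f-emb (suc M) = extend-isEmb j f-emb (family-isEmb j f-emb M)

  length-family : ∀ M → length (family M) * t + (a + b) ^ M ≡ 2 ^ (M * n)
  length-family zero = refl
  length-family (suc M) = begin
    length (extend (family M)) * t + (a + b) * S
      ≡⟨ cong (λ w → w * t + (a + b) * S) (length-extend (family M)) ⟩
    (a * K + (2 ^ (M * n) + b * K)) * t + (a + b) * S
      ≡⟨ cong (λ w → (a * K + (w + b * K)) * t + (a + b) * S) (length-family M) ⟨
    (a * K + ((K * t + S) + b * K)) * t + (a + b) * S
      ≡⟨ solve 5 (λ a b K t S → (a :* K :+ ((K :* t :+ S) :+ b :* K)) :* t :+ (a :+ b) :* S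
                             := (a :+ t :+ b) :* (K :* t :+ S)) refl a b K t S ⟩
    (a + t + b) * (K * t + S)
      ≡⟨ cong₂ _*_ a+t+b≡2^n (length-family M) ⟩
    2 ^ n * 2 ^ (M * n)
      ≡⟨ ^-distribˡ-+-* 2 n (M * n) ⟨
    2 ^ (n + M * n) ∎
    where
    open ≡-Reasoning
    open import Data.Nat.Solver using (module +-*-Solver)
    open +-*-Solver
    K S : ℕ
    K = length (family M)
    S = (a + b) ^ M

SeparatedFamily : (m : ℕ) → Rel (Fin (suc m)) ℓ → (p q : ℕ) → J → (t : ℕ) → Set ℓ
SeparatedFamily m R p q j t = Σ ℕ λ N → Σ ℕ λ K → Σ (Fin K → Fin (suc m) → Subset N) λ f →
  (0 < N) × (0 < K) × (∀ i → IsEmb j R (f i)) × (2 ^ N * (q ∸ p) ≤ K * t * q)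
  × (∀ i₁ i₂ → i₁ Data.Fin.< i₂ → f i₁ ⊉ᶠ f i₂)

separatedFamily : ∀ {R : Rel (Fin (suc m)) ℓ} j (f : Fin (suc m) → Subset (suc n)) → IsEmb j R f →
  ∀ p q → 0 < p → SeparatedFamily m R p q j (convSize f)
separatedFamily {m = m} {n = n} {R = R} j f f-emb p q 0<p =
  subst (SeparatedFamily m R p q j) (sym (convSize-subsets f))
    ( M * suc n
    , length (family M)
    , lookup (family M)
    , s≤s z≤n
    , 0<length-extend _
    , All-lookup (family-isEmb j f-emb M)
    , *-∸-bound {K = length (family M)} p q 0<p (length-family M) [a+b]^M*q≤2^[M*n]
    , AllPairs-lookup (family-⊉ᶠ M)
    )
  where
  open Extension f
  M : ℕ
  M = suc ((a + b) * q)
  0<t : 0 < t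
  0<t = filter-some (inConv? f) (lose (∈-subsets (f fzero)) (fzero , fzero , ⊆-refl , ⊆-refl))
  [a+b]^M*q≤2^[M*n] : (a + b) ^ M * q ≤ 2 ^ (M * suc n)
  [a+b]^M*q≤2^[M*n] = begin
    (a + b) ^ M * q     ≤⟨ m^[1+m*q]*q≤[1+m]^[1+m*q] (a + b) q ⟩
    suc (a + b) ^ M     ≤⟨ ^-monoˡ-≤ M (a+b<2^n 0<t) ⟩
    (2 ^ suc n) ^ M     ≡⟨ ^-*-assoc 2 (suc n) M ⟩
    2 ^ (suc n * M)     ≡⟨ cong (2 ^_) (*-comm (suc n) M) ⟩
    2 ^ (M * suc n)     ∎
    where open ≤-Reasoning

⊆-B₀ : (p q : Subset 0) → p ⊆ q
⊆-B₀ _ _ {()}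

convSize-B₀ : (g : Fin (suc m) → Subset 0) → convSize g ≡ 1
convSize-B₀ g = cong length (filter-accept (inConv? g) (fzero , fzero , ⊆-B₀ _ _ , ⊆-B₀ _ _))

lemma3 : {ℓ : Level} (m : ℕ) (_<ₚ_ : Rel (Fin (suc m)) ℓ)
    → IsStrictPartialOrder _≡_ _<ₚ_
    → (p q : ℕ) → 0 < p → 0 < q
    → (j : J) (t : ℕ) → IsT j _<ₚ_ t
    → Σ ℕ λ N → Σ ℕ λ K → Σ (Fin K → Fin (suc m) → Subset N) λ f →
        (0 < N) × (0 < K)
        × (∀ i → IsEmb j _<ₚ_ (f i))
        × ((2 ^ N) * (q ∸ p) ≤ K * t * q)
        × (∀ (i₁ i₂ : Fin K) → Data.Fin._<_ i₁ i₂ → ∀ (x y : Fin (suc m)) → ¬ (f i₂ y ⊆ f i₁ x))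
lemma3 m R _ p q 0<p _ j _ ((suc n , f , f-emb , refl) , _) = separatedFamily j f f-emb p q 0<p
-- B₀ is a point, so by injectivity so is P, and t = 1; then P is embedded into B₁ instead.
lemma3 (suc m) R _ p q 0<p _ j _ ((zero , f , f-emb , refl) , _) =
  contradiction (IsEmb-injective j f-emb {fzero} {fsuc fzero} (⊆-antisym (⊆-B₀ _ _) (⊆-B₀ _ _))) λ ()
lemma3 zero R spo p q 0<p _ j _ ((zero , f , f-emb , refl) , _) =
  subst (SeparatedFamily zero R p q j) (sym (convSize-B₀ f))
    (separatedFamily j (const (outside ∷ [])) (onePoint-isEmb spo j (outside ∷ [])) p q 0<p)
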